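{- Let $\mathbf{t}=T(\mathbf{f})$ be the ternary word obtained from the Fibonacci word $\mathbf{f}$ by replacing every second occurrence of $0$, starting with the second one, by $2$. Then $\mathbf{t}$ does not have the Frobenius property.
   Context: Let $\varphi=(1+\sqrt5)/2$ and $\alpha=2-\varphi$. The Fibonacci word is $\mathbf{f}=(\lfloor (n+1)\alpha\rfloor-\lfloor n\alpha\rfloor)_{n\ge1}=01001010010010100\cdots$ over $\{0,1\}$. $T$ keeps each $1$, and among the occurrences of $0$ (in order) keeps the 1st, 3rd, 5th, $\dots$ as $0$ and replaces the 2nd, 4th, 6th, $\dots$ by $2$; thus $\mathbf{t}=01201210210210120\cdots$. For an infinite word $\mathbf{w}$, $\mathcal{L}_{\mathbf{w}}$ is its set of factors. A semigroup homomorphism $S:\{0,1,2\}^*\to\mathbb{N}$ is determined by $S(0),S(1),S(2)$ via $S(uv)=S(u)+S(v)$, and $S(\mathcal{L}_{\mathbf{w}})=\{S(u):u\in\mathcal{L}_{\mathbf{w}}\}$. A ternary infinite word $\mathbf{w}$ has the Frobenius property if for every such $S$ with $S(0),S(1),S(2)$ non-negative integers and $\gcd(S(0),S(1),S(2))=1$, the set $S(\mathcal{L}_{\mathbf{w}})$ contains all but finitely many elements of $\mathbb{N}$. -}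

module Defs where

open import Data.Nat using (ℕ; zero; suc; _+_; _*_; _∸_; _≤_; _≤?_)
open import Data.Nat.DivMod using (_/_; _%_)
open import Data.Nat.GCD using (gcd)
open import Data.Fin using (Fin; zero; suc)
open import Data.List using (List; map; upTo)
open import Data.Nat.ListAction using (sum)
open import Data.Product using (∃; ∃-syntax; _×_)
open import Relation.Binary.PropositionalEquality using (_≡_)
open import Relation.Nullary using (yes; no; ¬_)

isqrtFrom : ℕ → ℕ → ℕ
isqrtFrom m zero = zero
isqrtFrom m (suc k) with suc k * suc k ≤? m
... | yes _ = suc k
... | no  _ = isqrtFrom m k

isqrt : ℕ → ℕ
isqrt m = isqrtFrom m m

-- ⌊ n α ⌋ with α = 2 - φ = (3 - √5)/2.
-- For n ≥ 1, √(5n²) is irrational, so ⌊3n - √(5n²)⌋ = 3n - isqrt(5n²) - 1,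
-- and ⌊x/2⌋ = ⌊⌊x⌋/2⌋.  For n = 0 the formula also gives 0.
floorNα : ℕ → ℕ
floorNα n = (3 * n ∸ isqrt (5 * (n * n)) ∸ 1) / 2

-- Fibonacci word, paper's indexing n ≥ 1: f_n = ⌊(n+1)α⌋ - ⌊nα⌋
fibLetter : ℕ → ℕ
fibLetter n = floorNα (suc n) ∸ floorNα n

-- infinite word as a function on positions 0,1,2,...; position i holds f_{i+1}
fib : ℕ → ℕ
fib i = fibLetter (suc i)

zerosBefore : ℕ → ℕ
zerosBefore zero = zero
zerosBefore (suc i) with fib i
... | zero = suc (zerosBefore i)
... | suc _ = zerosBefore i

-- T(f): keep 1's; the (k+1)-st occurrence of 0 stays 0 if k is even, becomes 2 if k is odd
tWord : ℕ → Fin 3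
tWord i with fib i
... | suc _ = suc zero
... | zero with zerosBefore i % 2
...   | zero = zero
...   | suc _ = suc (suc zero)

factor : (ℕ → Fin 3) → ℕ → ℕ → List (Fin 3)
factor w i l = map (λ k → w (i + k)) (upTo l)

letterWeight : ℕ → ℕ → ℕ → Fin 3 → ℕ
letterWeight a b c zero = a
letterWeight a b c (suc zero) = b
letterWeight a b c (suc (suc zero)) = c

S : ℕ → ℕ → ℕ → List (Fin 3) → ℕ
S a b c u = sum (map (letterWeight a b c) u)

InImage : ℕ → ℕ → ℕ → (ℕ → Fin 3) → ℕ → Set
InImage a b c w m = ∃[ i ] ∃[ l ] S a b c (factor w i l) ≡ m

Frobenius : (ℕ → Fin 3) → Set
Frobenius w = ∀ a b c → gcd (gcd a b) c ≡ 1 →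
  ∃[ N ] (∀ m → N ≤ m → InImage a b c w m)

module Submission where

-- The word t = T(f) fails the Frobenius property already for the weights
-- S(0) = 1, S(1) = 0, S(2) = 3, whose gcd is 1.
--
-- Idea: the letters 0 and 2 of t alternate (0, 2, 0, 2, ...), so the weight
-- of the length-i prefix of t only depends on the number n of zeros of f
-- before position i: it is q n, where q 0 = 0, q 1 = 1, q (n + 2) = q n + 4.
-- Hence every prefix weight is 0 or 1 modulo 4.  The weight of a factor is
-- the difference of two prefix weights (a telescoping sum), so it is never
-- 2 modulo 4, and the infinitely many numbers 2 + 4N are all missing from
-- S(L_t).  The argument uses nothing about f except the definition of T.

open import Defs
open import Relation.Nullary using (¬_)
open import Data.Nat using (ℕ; zero; suc; _+_; _*_; _≤_; z≤n; s≤s)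
open import Data.Nat.Properties
  using (+-assoc; +-comm; +-identityʳ; +-suc; m≤n+m; m≤m*n; ≤-trans; <-irrefl)
open import Data.Nat.DivMod using (_%_; %-distribˡ-+; [m+n]%n≡m%n; [m+kn]%n≡m%n)
open import Data.Fin using (Fin)
open import Data.List using (map; applyUpTo)
open import Data.List.Properties using (map-upTo)
open import Data.Nat.ListAction using (sum)
open import Data.Product using (_,_)
open import Relation.Binary.PropositionalEquality
  using (_≡_; _≢_; refl; sym; trans; cong; cong₂; subst; module ≡-Reasoning)

telescope : (g : Fin 3 → ℕ) (P : ℕ → ℕ) (v : ℕ → Fin 3) →
            (∀ k → P (suc k) ≡ P k + g (v k)) →
            ∀ l → P l ≡ P 0 + sum (map g (applyUpTo v l))
telescope g P v grows zero = sym (+-identityʳ (P 0))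
telescope g P v grows (suc l) = begin
  P (suc l)
    ≡⟨ telescope g (λ k → P (suc k)) (λ k → v (suc k)) (λ k → grows (suc k)) l ⟩
  P 1 + rest
    ≡⟨ cong (_+ rest) (grows 0) ⟩
  P 0 + g (v 0) + rest
    ≡⟨ +-assoc (P 0) (g (v 0)) rest ⟩
  P 0 + sum (map g (applyUpTo v (suc l)))
    ∎
  where
  open ≡-Reasoning
  rest : ℕ
  rest = sum (map g (applyUpTo (λ k → v (suc k)) l))

factor-weight : ∀ a b c (w : ℕ → Fin 3) (P : ℕ → ℕ) →
                (∀ i → P (suc i) ≡ P i + letterWeight a b c (w i)) →
                ∀ i l → P (i + l) ≡ P i + S a b c (factor w i l)
factor-weight a b c w P grows i l = begin
  P (i + l)
    ≡⟨ telescope g (λ k → P (i + k)) (λ k → w (i + k)) shifted l ⟩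
  P (i + 0) + sum (map g (applyUpTo (λ k → w (i + k)) l))
    ≡⟨ cong₂ _+_ (cong P (+-identityʳ i))
                 (cong (λ u → sum (map g u)) (sym (map-upTo (λ k → w (i + k)) l))) ⟩
  P i + S a b c (factor w i l)
    ∎
  where
  open ≡-Reasoning
  g : Fin 3 → ℕ
  g = letterWeight a b c
  shifted : ∀ k → P (i + suc k) ≡ P (i + k) + g (w (i + k))
  shifted k = trans (cong P (+-suc i k)) (grows (i + k))

residue-gap : ∀ x y d → x % 4 ≤ 1 → y % 4 ≤ 1 → d % 4 ≡ 2 → y ≢ x + d
residue-gap x y d x-low y-low d≡2 refl = <-irrefl refl (≤-trans (shifted-high (x % 4) x-low) sum-low)
  where
  shifted-high : ∀ r → r ≤ 1 → 2 ≤ (r + 2) % 4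
  shifted-high zero       z≤n       = s≤s (s≤s z≤n)
  shifted-high (suc zero) (s≤s z≤n) = s≤s (s≤s z≤n)
  sum-low : (x % 4 + 2) % 4 ≤ 1
  sum-low = subst (_≤ 1) (trans (%-distribˡ-+ x d 4) (cong (λ r → (x % 4 + r) % 4) d≡2)) y-low

-- (3) The potential: q n is the total weight of the first n letters 0/2
-- of t, which alternate 0, 2, 0, 2, ... and weigh 1, 3, 1, 3, ...
q : ℕ → ℕ
q zero          = 0
q (suc zero)    = 1
q (suc (suc n)) = q n + 4

q-residue : ∀ n → q n % 4 ≤ 1
q-residue zero          = z≤n
q-residue (suc zero)    = s≤s z≤n
q-residue (suc (suc n)) = subst (_≤ 1) (sym ([m+n]%n≡m%n (q n) 4)) (q-residue n)

private
  swap-four : ∀ x k → x + k + 4 ≡ x + 4 + k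
  swap-four x k = trans (+-assoc x k 4) (trans (cong (x +_) (+-comm k 4)) (sym (+-assoc x 4 k)))

-- An even-numbered occurrence of 0 in f stays 0 in t and weighs 1 ...
q-step-even : ∀ n → n % 2 ≡ 0 → q (suc n) ≡ q n + 1
q-step-even zero          _      = refl
q-step-even (suc zero)    ()
q-step-even (suc (suc n)) parity = trans (cong (_+ 4) (q-step-even n parity)) (swap-four (q n) 1)

-- ... and an odd-numbered one becomes 2 and weighs 3.  (In both proofs
-- (n + 2) % 2 reduces to n % 2 by computation.)
q-step-odd : ∀ {k} n → n % 2 ≡ suc k → q (suc n) ≡ q n + 3
q-step-odd zero          ()
q-step-odd (suc zero)    _      = refl
q-step-odd (suc (suc n)) parity = trans (cong (_+ 4) (q-step-odd n parity)) (swap-four (q n) 3)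

-- The weight of the prefix of t of length i; it increases by the weight of
-- each letter of t, so factor-weight applies to it.
Q : ℕ → ℕ
Q i = q (zerosBefore i)

Q-step : ∀ i → Q (suc i) ≡ Q i + letterWeight 1 0 3 (tWord i)
Q-step i with fib i
... | suc _ = sym (+-identityʳ (Q i))
... | zero with zerosBefore i % 2 in parity
...   | zero  = q-step-even (zerosBefore i) parity
...   | suc _ = q-step-odd (zerosBefore i) parity

theorem18 : ¬ Frobenius tWord
theorem18 frobenius with frobenius 1 0 3 refl
... | N , covers with covers (2 + N * 4) (≤-trans (m≤m*n N 4) (m≤n+m (N * 4) 2))
... | i , l , weight≡ =
  residue-gap (Q i) (Q (i + l)) (2 + N * 4) (q-residue (zerosBefore i)) (q-residue (zerosBefore (i + l)))
    ([m+kn]%n≡m%n 2 N 4)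
    (trans (factor-weight 1 0 3 tWord Q Q-step i l) (cong (Q i +_) weight≡))
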